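{- For every integer $k\ge 2$ we have $\Delta_k(1)=1/2$; consequently, for every $k\ge 2$ the function $n\mapsto\Delta_k(n)$ is not strictly increasing.
   Context: For $k\ge 1$ and $n\ge 0$, $\Delta_k(n)$ is the supremum of the upper densities of sets $S\subseteq\mathbb{Z}^k$ such that for each $x\in S$ there are at most $n$ points $x'\in S$ at Euclidean distance $1$ from $x$. The upper density of $S\subseteq\mathbb{Z}^k$ is $\limsup_{r\to\infty}|{\sf B}_r\cap S|/|{\sf B}_r|$, where ${\sf B}_r=\{x\in\mathbb{Z}^k:\max_i|x_i|<r\}$. -}

module Defs where

open import Data.Bool using (Bool; true; false; _∧_)
open import Data.Nat as ℕ using (ℕ; zero; suc)
open import Data.Integer as ℤ using (ℤ; +_; -[1+_])
open import Data.Rational as ℚ using (ℚ; 0ℚ; ½)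
open import Data.List using (List; []; _∷_; [_]; map; concatMap; length; upTo)
open import Data.Vec using (Vec; []; _∷_)
open import Data.Product using (Σ; ∃; ∃-syntax; _×_)
open import Relation.Nullary using (¬_; does)
open import Relation.Binary.PropositionalEquality using (_≡_)

Point : ℕ → Set
Point k = Vec ℤ k

Subset : ℕ → Set
Subset k = Point k → Bool

countB : {A : Set} → (A → Bool) → List A → ℕ
countB p [] = 0
countB p (x ∷ xs) with p x
... | true  = suc (countB p xs)
... | false = countB p xs

-- integers z with |z| < r, i.e. -(r-1), ..., r-1
symRange : ℕ → List ℤ
symRange zero    = []
symRange (suc m) = map (λ i → (+ i) ℤ.- (+ m)) (upTo (suc (2 ℕ.* m)))

-- the box B_r = { x ∈ ℤ^k : max_i |x_i| < r }, enumerated as a list (no repetitions)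
box : (k : ℕ) → ℕ → List (Point k)
box zero    r = [ [] ]
box (suc k) r = concatMap (λ z → map (z ∷_) (box k r)) (symRange r)

sqDist : {k : ℕ} → Point k → Point k → ℤ
sqDist []       []       = + 0
sqDist (x ∷ xs) (y ∷ ys) = (x ℤ.- y) ℤ.* (x ℤ.- y) ℤ.+ sqDist xs ys

unitDist : {k : ℕ} → Point k → Point k → Bool
unitDist x y = does (sqDist x y ℤ.≟ + 1)

-- all y with max_i |y_i - x_i| ≤ 1 (no repetitions); every point at
-- Euclidean distance 1 from x lies in this list
cube1 : {k : ℕ} → Point k → List (Point k)
cube1 []       = [ [] ]
cube1 (x ∷ xs) = concatMap (λ d → map ((x ℤ.+ d) ∷_) (cube1 xs)) (-[1+ 0 ] ∷ + 0 ∷ + 1 ∷ [])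

MaxUnitDeg : (k : ℕ) → Subset k → ℕ → Set
MaxUnitDeg k S n = ∀ x → S x ≡ true → countB (λ y → S y ∧ unitDist x y) (cube1 x) ℕ.≤ n

cnt : (k : ℕ) → Subset k → ℕ → ℚ
cnt k S r = (+ countB S (box k r)) ℚ./ 1

vol : (k : ℕ) → ℕ → ℚ
vol k r = (+ length (box k r)) ℚ./ 1

-- upper density of S is ≤ q :  limsup_r |B_r ∩ S|/|B_r| ≤ q
UpperDensity≤ : (k : ℕ) → Subset k → ℚ → Set
UpperDensity≤ k S q =
  ∀ ε → 0ℚ ℚ.< ε → ∃[ R ] ∀ r → R ℕ.≤ r → cnt k S r ℚ.≤ (q ℚ.+ ε) ℚ.* vol k r

-- upper density of S is ≥ q :  limsup_r |B_r ∩ S|/|B_r| ≥ q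
UpperDensity≥ : (k : ℕ) → Subset k → ℚ → Set
UpperDensity≥ k S q =
  ∀ ε → 0ℚ ℚ.< ε → ∀ R → ∃[ r ] (R ℕ.≤ r × (q ℚ.- ε) ℚ.* vol k r ℚ.≤ cnt k S r)

-- Δ_k(n) ≤ q  (the supremum is ≤ q)
Δ≤ : ℕ → ℕ → ℚ → Set
Δ≤ k n q = ∀ (S : Subset k) → MaxUnitDeg k S n → UpperDensity≤ k S q

Δ≥ : ℕ → ℕ → ℚ → Set
Δ≥ k n q = ∀ ε → 0ℚ ℚ.< ε → Σ (Subset k) λ S → MaxUnitDeg k S n × UpperDensity≥ k S (q ℚ.- ε)

Δ≡ : ℕ → ℕ → ℚ → Set
Δ≡ k n q = Δ≤ k n q × Δ≥ k n q

Δ< : ℕ → ℕ → ℕ → Set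
Δ< k m n = ∃[ q₁ ] ∃[ q₂ ] (q₁ ℚ.< q₂ × Δ≤ k m q₁ × Δ≥ k n q₂)

ΔStrictlyIncreasing : ℕ → Set
ΔStrictlyIncreasing k = ∀ m n → m ℕ.< n → Δ< k m n

-- If every point of S ⊆ ℤ^k (k ≥ 2) has at most one unit neighbour in S, then every unit square in the
-- first two coordinates contains at most two points of S: among three corners of a square, one has the
-- other two as neighbours. Pairing adjacent rows and columns of a box of side N, S covers at most
-- (N + 1)² / (2 N²) of it, so Δ_k(1) ≤ ½. The checkerboard (even coordinate sum) has no unit neighbours
-- at all and covers at least (N - 1) / (2 N) of each box, so Δ_k(0) ≥ ½ ≥ Δ_k(1).

module Submission where

open import Defs
open import Data.Bool using (Bool; true; false; not; _∧_; _xor_)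
open import Data.Bool.Properties using (not-involutive; xor-assoc; not-distribˡ-xor; not-distribʳ-xor; ∧-zeroʳ)
open import Data.Empty using (⊥; ⊥-elim)
open import Data.Integer as ℤ using (ℤ; +_; -[1+_]; +[1+_]; +0; 1ℤ; _◃_)
import Data.Integer.Properties as ℤ
open import Data.List using (List; []; _∷_; _++_; map; concatMap; length; upTo)
open import Data.List.Properties using (map-∘; map-cong; length-upTo; map-upTo; map-applyUpTo)
open import Data.List.Membership.Propositional using (_∈_)
open import Data.List.Membership.Propositional.Properties using (∈-map⁺; ∈-++⁺ˡ; ∈-++⁺ʳ)
open import Data.List.Relation.Unary.All as All using (All; []; _∷_)
open import Data.List.Relation.Unary.All.Properties using (map⁺; ++⁺)
open import Data.List.Relation.Unary.Any using (here; there)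
open import Data.Nat using (ℕ; zero; suc; _+_; _*_; _≤_; z≤n; s≤s; NonZero)
open import Data.Nat.ListAction using (sum)
open import Data.Nat.Properties
open import Data.Product using (_×_; _,_; ∃-syntax)
open import Data.Rational as ℚ using (ℚ; mkℚ; 0ℚ; ½)
import Data.Rational.Properties as ℚ
open import Data.Rational.Unnormalised as ℚᵘ using (mkℚᵘ)
import Data.Rational.Unnormalised.Properties as ℚᵘ
import Data.Nat.Coprimality as Coprime
import Data.Sign as Sign
open import Data.Vec using ([]; _∷_)
open import Function using (_∘_; case_of_)
open import Relation.Nullary using (¬_; does; yes; no)
open import Relation.Binary.PropositionalEquality
open import Algebra.Properties.CommutativeSemigroup +-commutativeSemigroup using (interchange)

boolToℕ : Bool → ℕ
boolToℕ true  = 1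
boolToℕ false = 0

boolToℕ≤1 : ∀ b → boolToℕ b ≤ 1
boolToℕ≤1 true  = s≤s z≤n
boolToℕ≤1 false = z≤n

module _ {A : Set} where

  sum-map-+ : ∀ (f g : A → ℕ) xs → sum (map (λ x → f x + g x) xs) ≡ sum (map f xs) + sum (map g xs)
  sum-map-+ f g []       = refl
  sum-map-+ f g (x ∷ xs) =
    trans (cong (λ s → f x + g x + s) (sum-map-+ f g xs)) (interchange (f x) (g x) _ _)

  sum-map-mono : ∀ {f g : A → ℕ} → (∀ x → f x ≤ g x) → ∀ xs → sum (map f xs) ≤ sum (map g xs)
  sum-map-mono f≤g []       = z≤n
  sum-map-mono f≤g (x ∷ xs) = +-mono-≤ (f≤g x) (sum-map-mono f≤g xs)

  sum-map-const : ∀ c (xs : List A) → sum (map (λ _ → c) xs) ≡ length xs * c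
  sum-map-const c []       = refl
  sum-map-const c (x ∷ xs) = cong (λ s → c + s) (sum-map-const c xs)

  countB≡sum : ∀ (p : A → Bool) xs → countB p xs ≡ sum (map (boolToℕ ∘ p) xs)
  countB≡sum p []       = refl
  countB≡sum p (x ∷ xs) with p x
  ... | true  = cong suc (countB≡sum p xs)
  ... | false = countB≡sum p xs

  countB-++ : ∀ (p : A → Bool) xs ys → countB p (xs ++ ys) ≡ countB p xs + countB p ys
  countB-++ p []       ys = refl
  countB-++ p (x ∷ xs) ys with p x
  ... | true  = cong suc (countB-++ p xs ys)
  ... | false = countB-++ p xs ys

  countB≤length : ∀ (p : A → Bool) xs → countB p xs ≤ length xs
  countB≤length p xs = begin
    countB p xs                      ≡⟨ countB≡sum p xs ⟩
    sum (map (boolToℕ ∘ p) xs)       ≤⟨ sum-map-mono (boolToℕ≤1 ∘ p) xs ⟩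
    sum (map (λ _ → 1) xs)           ≡⟨ sum-map-const 1 xs ⟩
    length xs * 1                    ≡⟨ *-identityʳ _ ⟩
    length xs                        ∎
    where open ≤-Reasoning

  countB-complement : ∀ (p q : A → Bool) → (∀ x → q x ≡ not (p x)) →
                      ∀ xs → countB p xs + countB q xs ≡ length xs
  countB-complement p q q≡¬p xs = begin
    countB p xs + countB q xs                                      ≡⟨ cong₂ _+_ (countB≡sum p xs) (countB≡sum q xs) ⟩
    sum (map (boolToℕ ∘ p) xs) + sum (map (boolToℕ ∘ q) xs)        ≡⟨ sum-map-+ (boolToℕ ∘ p) (boolToℕ ∘ q) xs ⟨
    sum (map (λ x → boolToℕ (p x) + boolToℕ (q x)) xs)             ≡⟨ cong sum (map-cong one xs) ⟩
    sum (map (λ _ → 1) xs)                                         ≡⟨ sum-map-const 1 xs ⟩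
    length xs * 1                                                  ≡⟨ *-identityʳ _ ⟩
    length xs                                                      ∎
    where
    open ≡-Reasoning
    one : ∀ x → boolToℕ (p x) + boolToℕ (q x) ≡ 1
    one x rewrite q≡¬p x with p x
    ... | true  = refl
    ... | false = refl

module _ {A B : Set} where

  countB-map : ∀ (p : B → Bool) (f : A → B) xs → countB p (map f xs) ≡ countB (p ∘ f) xs
  countB-map p f xs = trans (countB≡sum p (map f xs))
    (trans (cong sum (sym (map-∘ xs))) (sym (countB≡sum (p ∘ f) xs)))

  countB-concatMap : ∀ (p : B → Bool) (f : A → List B) xs →
                     countB p (concatMap f xs) ≡ sum (map (countB p ∘ f) xs)
  countB-concatMap p f []       = refl
  countB-concatMap p f (x ∷ xs) =
    trans (countB-++ p (f x) (concatMap f xs)) (cong (λ s → countB p (f x) + s) (countB-concatMap p f xs))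

countB-true : ∀ {A : Set} (xs : List A) → countB (λ _ → true) xs ≡ length xs
countB-true []       = refl
countB-true (x ∷ xs) = cong suc (countB-true xs)

∈⇒1≤countB : ∀ {A : Set} (p : A → Bool) {x xs} → x ∈ xs → p x ≡ true → 1 ≤ countB p xs
∈⇒1≤countB p {xs = y ∷ xs} (here refl) px rewrite px = s≤s z≤n
∈⇒1≤countB p {xs = y ∷ xs} (there x∈xs) px with p y
... | true  = s≤s z≤n
... | false = ∈⇒1≤countB p x∈xs px

countB-none : ∀ {A : Set} (p : A → Bool) {xs} → All (λ x → p x ≡ false) xs → countB p xs ≡ 0
countB-none p []                = refl
countB-none p (px≡false ∷ none) rewrite px≡false = countB-none p none

countB-square≤ : ∀ {A : Set} (p q r s : A → Bool) →
                 (∀ x → boolToℕ (p x) + boolToℕ (q x) + (boolToℕ (r x) + boolToℕ (s x)) ≤ 2) →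
                 ∀ xs → countB p xs + countB q xs + (countB r xs + countB s xs) ≤ 2 * length xs
countB-square≤ {A} p q r s ≤2 xs = begin
  countB p xs + countB q xs + (countB r xs + countB s xs)
    ≡⟨ cong₂ _+_ (cong₂ _+_ (countB≡sum p xs) (countB≡sum q xs)) (cong₂ _+_ (countB≡sum r xs) (countB≡sum s xs)) ⟩
  ∑ₓ (boolToℕ ∘ p) + ∑ₓ (boolToℕ ∘ q) + (∑ₓ (boolToℕ ∘ r) + ∑ₓ (boolToℕ ∘ s))
    ≡⟨ cong₂ _+_ (sum-map-+ (boolToℕ ∘ p) (boolToℕ ∘ q) xs) (sum-map-+ (boolToℕ ∘ r) (boolToℕ ∘ s) xs) ⟨
  ∑ₓ (λ x → boolToℕ (p x) + boolToℕ (q x)) + ∑ₓ (λ x → boolToℕ (r x) + boolToℕ (s x))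
    ≡⟨ sum-map-+ (λ x → boolToℕ (p x) + boolToℕ (q x)) (λ x → boolToℕ (r x) + boolToℕ (s x)) xs ⟨
  ∑ₓ (λ x → boolToℕ (p x) + boolToℕ (q x) + (boolToℕ (r x) + boolToℕ (s x)))
    ≤⟨ sum-map-mono ≤2 xs ⟩
  ∑ₓ (λ _ → 2)
    ≡⟨ trans (sum-map-const 2 xs) (*-comm (length xs) 2) ⟩
  2 * length xs ∎
  where
  open ≤-Reasoning
  ∑ₓ : (A → ℕ) → ℕ
  ∑ₓ f = sum (map f xs)

-- Sums over index ranges

∑< : ℕ → (ℕ → ℕ) → ℕ
∑< n u = sum (map u (upTo n))

syntax ∑< n (λ i → e) = ∑[ i < n ] e

module _ where
  open ≡-Reasoning

  ∑<-suc : ∀ n u → ∑< (suc n) u ≡ u 0 + ∑< n (u ∘ suc)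
  ∑<-suc n u = cong (λ us → u 0 + sum us)
    (trans (map-applyUpTo suc u n) (sym (map-upTo (u ∘ suc) n)))

  ∑<-snoc : ∀ n u → ∑< (suc n) u ≡ ∑< n u + u n
  ∑<-snoc zero    u = +-comm (u 0) 0
  ∑<-snoc (suc n) u = begin
    ∑< (suc (suc n)) u                ≡⟨ ∑<-suc (suc n) u ⟩
    u 0 + ∑< (suc n) (u ∘ suc)        ≡⟨ cong (λ s → u 0 + s) (∑<-snoc n (u ∘ suc)) ⟩
    u 0 + (∑< n (u ∘ suc) + u (suc n)) ≡⟨ +-assoc (u 0) _ _ ⟨
    u 0 + ∑< n (u ∘ suc) + u (suc n)   ≡⟨ cong (λ s → s + u (suc n)) (∑<-suc n u) ⟨
    ∑< (suc n) u + u (suc n)           ∎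

  ∑<-+ : ∀ n u v → ∑[ i < n ] (u i + v i) ≡ ∑< n u + ∑< n v
  ∑<-+ n u v = sum-map-+ u v (upTo n)

  ∑<-const : ∀ n c → ∑[ i < n ] c ≡ n * c
  ∑<-const n c = trans (sum-map-const c (upTo n)) (cong (_* c) (length-upTo n))

  ∑<-mono : ∀ n {u v} → (∀ i → u i ≤ v i) → ∑< n u ≤ ∑< n v
  ∑<-mono n u≤v = sum-map-mono u≤v (upTo n)

  ∑<-cong : ∀ n {u v} → (∀ i → u i ≡ v i) → ∑< n u ≡ ∑< n v
  ∑<-cong n u≡v = cong sum (map-cong u≡v (upTo n))

  -- Each u i with 0 < i < n is counted twice among the consecutive pairs.
  ∑<-pairs : ∀ n u → u 0 + ∑[ i < n ] (u i + u (suc i)) ≡ ∑< n u + ∑< (suc n) u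
  ∑<-pairs n u = begin
    u 0 + ∑[ i < n ] (u i + u (suc i))   ≡⟨ cong (λ s → u 0 + s) (∑<-+ n u (u ∘ suc)) ⟩
    u 0 + (∑< n u + ∑< n (u ∘ suc))      ≡⟨ +-assoc (u 0) _ _ ⟨
    u 0 + ∑< n u + ∑< n (u ∘ suc)        ≡⟨ cong (λ s → s + ∑< n (u ∘ suc)) (+-comm (u 0) _) ⟩
    ∑< n u + u 0 + ∑< n (u ∘ suc)        ≡⟨ +-assoc (∑< n u) _ _ ⟩
    ∑< n u + (u 0 + ∑< n (u ∘ suc))      ≡⟨ cong (λ s → ∑< n u + s) (∑<-suc n u) ⟨
    ∑< n u + ∑< (suc n) u                ∎

∑<-pairs-≤ : ∀ n u B → (∀ i → u i + u (suc i) ≤ B) → 2 * ∑< n u ≤ suc n * B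
∑<-pairs-≤ n u B pair≤ = begin
  2 * ∑< n u                              ≡⟨ cong (λ s → ∑< n u + s) (+-identityʳ _) ⟩
  ∑< n u + ∑< n u                         ≤⟨ +-monoʳ-≤ (∑< n u) (≤-trans (m≤m+n _ (u n)) (≤-reflexive (sym (∑<-snoc n u)))) ⟩
  ∑< n u + ∑< (suc n) u                   ≡⟨ ∑<-pairs n u ⟨
  u 0 + ∑[ i < n ] (u i + u (suc i))      ≤⟨ +-mono-≤ (≤-trans (m≤m+n (u 0) (u 1)) (pair≤ 0)) (∑<-mono n pair≤) ⟩
  B + ∑[ i < n ] B                        ≡⟨ cong (λ s → B + s) (∑<-const n B) ⟩
  suc n * B                               ∎
  where open ≤-Reasoning

∑<-pairs-≥ : ∀ n u B → (∀ i → B ≤ u i + u (suc i)) → n * B ≤ 2 * ∑< n u + u n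
∑<-pairs-≥ n u B ≤pair = begin
  n * B                                   ≡⟨ ∑<-const n B ⟨
  ∑[ i < n ] B                            ≤⟨ ∑<-mono n ≤pair ⟩
  ∑[ i < n ] (u i + u (suc i))            ≤⟨ m≤n+m _ (u 0) ⟩
  u 0 + ∑[ i < n ] (u i + u (suc i))      ≡⟨ ∑<-pairs n u ⟩
  ∑< n u + ∑< (suc n) u                   ≡⟨ cong (λ s → ∑< n u + s) (∑<-snoc n u) ⟩
  ∑< n u + (∑< n u + u n)                 ≡⟨ +-assoc (∑< n u) _ _ ⟨
  ∑< n u + ∑< n u + u n                   ≡⟨ cong (λ s → ∑< n u + s + u n) (+-identityʳ _) ⟨
  2 * ∑< n u + u n                        ∎
  where open ≤-Reasoning

side : ℕ → ℕ
side m = suc (2 * m)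

symIndex : ℕ → ℕ → ℤ
symIndex m i = + i ℤ.- + m

symIndex-suc : ∀ m i → symIndex m (suc i) ≡ symIndex m i ℤ.+ 1ℤ
symIndex-suc m i = trans (cong (λ z → z ℤ.- + m) (cong +_ (+-comm 1 i))) (shift (+ i) (+ m))
  where
  open import Data.Integer.Tactic.RingSolver
  shift : ∀ a b → (a ℤ.+ 1ℤ) ℤ.- b ≡ (a ℤ.- b) ℤ.+ 1ℤ
  shift = solve-∀

-- symRange (suc m) is, definitionally, map (symIndex m) (upTo (side m)).
countB-box : ∀ k m (p : Point (suc k) → Bool) →
             countB p (box (suc k) (suc m)) ≡ ∑[ i < side m ] countB (λ x → p (symIndex m i ∷ x)) (box k (suc m))
countB-box k m p = begin
  countB p (concatMap slice (map (symIndex m) (upTo (side m))))  ≡⟨ countB-concatMap p slice (map (symIndex m) (upTo (side m))) ⟩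
  sum (map (countB p ∘ slice) (map (symIndex m) (upTo (side m)))) ≡⟨ cong sum (map-∘ {g = countB p ∘ slice} {f = symIndex m} (upTo (side m))) ⟨
  sum (map (countB p ∘ slice ∘ symIndex m) (upTo (side m)))       ≡⟨ ∑<-cong (side m) (λ i → countB-map p _ (box k (suc m))) ⟩
  ∑[ i < side m ] countB (λ x → p (symIndex m i ∷ x)) (box k (suc m)) ∎
  where
  open ≡-Reasoning
  slice : ℤ → List (Point (suc k))
  slice z = map (z ∷_) (box k (suc m))

length-box : ∀ k m → length (box (suc k) (suc m)) ≡ side m * length (box k (suc m))
length-box k m = begin
  length (box (suc k) (suc m))                         ≡⟨ countB-true (box (suc k) (suc m)) ⟨
  countB (λ _ → true) (box (suc k) (suc m))            ≡⟨ countB-box k m (λ _ → true) ⟩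
  ∑[ i < side m ] countB (λ _ → true) (box k (suc m))  ≡⟨ ∑<-const (side m) (countB (λ _ → true) (box k (suc m))) ⟩
  side m * countB (λ _ → true) (box k (suc m))         ≡⟨ cong (side m *_) (countB-true (box k (suc m))) ⟩
  side m * length (box k (suc m))                      ∎
  where open ≡-Reasoning

length-box-pos : ∀ k m → 1 ≤ length (box k (suc m))
length-box-pos zero    m = s≤s z≤n
length-box-pos (suc k) m = subst (1 ≤_) (sym (length-box k m)) (*-mono-≤ {1} {side m} (s≤s z≤n) (length-box-pos k m))

-- Points with at most one unit neighbour

sqDist-refl : ∀ {k} (x : Point k) → sqDist x x ≡ + 0
sqDist-refl []      = refl
sqDist-refl (a ∷ x) rewrite sqDist-refl x | ℤ.+-inverseʳ a = refl

sqDist-∷-same : ∀ {k} a (x y : Point k) → sqDist (a ∷ x) (a ∷ y) ≡ sqDist x y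
sqDist-∷-same a x y rewrite ℤ.+-inverseʳ a = ℤ.+-identityˡ (sqDist x y)

unitStep-square : ∀ s a → (a ℤ.- (a ℤ.+ (s ◃ 1))) ℤ.* (a ℤ.- (a ℤ.+ (s ◃ 1))) ≡ 1ℤ
unitStep-square Sign.- = solve-∀
  where open import Data.Integer.Tactic.RingSolver
unitStep-square Sign.+ = solve-∀
  where open import Data.Integer.Tactic.RingSolver

sqDist-step : ∀ {k} s a (x : Point k) → sqDist (a ∷ x) ((a ℤ.+ (s ◃ 1)) ∷ x) ≡ 1ℤ
sqDist-step s a x rewrite sqDist-refl x = trans (ℤ.+-identityʳ _) (unitStep-square s a)

unitDist-sqDist : ∀ {k} (x y : Point k) → sqDist x y ≡ 1ℤ → unitDist x y ≡ true
unitDist-sqDist x y d≡1 = cong (λ d → does (d ℤ.≟ 1ℤ)) d≡1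

∈-cube1-step : ∀ {k} s a (x : Point k) → ((a ℤ.+ (s ◃ 1)) ∷ x) ∈ cube1 (a ∷ x)
∈-cube1 : ∀ {k} (x : Point k) → x ∈ cube1 x

∈-cube1-step Sign.- a x = ∈-++⁺ˡ (∈-map⁺ _ (∈-cube1 x))
∈-cube1-step Sign.+ a x = ∈-++⁺ʳ (map _ (cube1 x)) (∈-++⁺ʳ (map _ (cube1 x)) (∈-++⁺ˡ (∈-map⁺ _ (∈-cube1 x))))

∈-cube1 []      = here refl
∈-cube1 (a ∷ x) = ∈-++⁺ʳ (map _ (cube1 x))
  (∈-++⁺ˡ (subst (λ c → (c ∷ x) ∈ map ((a ℤ.+ + 0) ∷_) (cube1 x)) (ℤ.+-identityʳ a) (∈-map⁺ _ (∈-cube1 x))))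

-- The two neighbours lie in different blocks of cube1 v, those with first-coordinate offset s and 0.
no-corner : ∀ {k} {S : Subset (suc (suc k))} → MaxUnitDeg (suc (suc k)) S 1 →
            ∀ s t {a a′ b b′} {x : Point k} → a′ ≡ a ℤ.+ (s ◃ 1) → b′ ≡ b ℤ.+ (t ◃ 1) →
            S (a ∷ b ∷ x) ≡ true → S (a′ ∷ b ∷ x) ≡ true → S (a ∷ b′ ∷ x) ≡ true → ⊥
no-corner {k} {S} deg s t {a} {b = b} {x = x} refl refl Sv Sh Sw =
  <⇒≱ (s≤s (s≤s z≤n)) (≤-trans (two-blocks s h∈ w∈) (≤-trans (≤-reflexive (sym blocks)) (deg v Sv)))
  where
  v : Point (suc (suc k))
  v = a ∷ b ∷ x
  q : Point (suc (suc k)) → Bool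
  q y = S y ∧ unitDist v y
  block : ℤ → List (Point (suc (suc k)))
  block d = map ((a ℤ.+ d) ∷_) (cube1 (b ∷ x))
  c : ℤ → ℕ
  c d = countB q (block d)
  h∈ : 1 ≤ c (s ◃ 1)
  h∈ = ∈⇒1≤countB q (∈-map⁺ _ (∈-cube1 (b ∷ x))) (cong₂ _∧_ Sh (unitDist-sqDist v _ (sqDist-step s a (b ∷ x))))
  w∈ : 1 ≤ c (+ 0)
  w∈ = ∈⇒1≤countB q
         (subst (λ a₀ → (a₀ ∷ (b ℤ.+ (t ◃ 1)) ∷ x) ∈ block (+ 0)) (ℤ.+-identityʳ a) (∈-map⁺ _ (∈-cube1-step t b x)))
         (cong₂ _∧_ Sw (unitDist-sqDist v _ (trans (sqDist-∷-same a (b ∷ x) _) (sqDist-step t b x))))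
  blocks : countB q (cube1 v) ≡ c (-[1+ 0 ]) + (c (+ 0) + (c 1ℤ + 0))
  blocks = countB-concatMap q (λ d → block d) (-[1+ 0 ] ∷ + 0 ∷ 1ℤ ∷ [])
  two-blocks : ∀ s → 1 ≤ c (s ◃ 1) → 1 ≤ c (+ 0) → 2 ≤ c (-[1+ 0 ]) + (c (+ 0) + (c 1ℤ + 0))
  two-blocks Sign.- h w = ≤-trans (+-mono-≤ h w) (+-monoʳ-≤ (c (-[1+ 0 ])) (m≤m+n (c (+ 0)) _))
  two-blocks Sign.+ h w = ≤-trans (+-mono-≤ w h) (≤-trans (+-monoʳ-≤ (c (+ 0)) (m≤m+n (c 1ℤ) 0))
                                                          (m≤n+m _ (c (-[1+ 0 ]))))

-- Any three corners of a square contain a corner together with both of its neighbours.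
square≤2 : ∀ p₀₀ p₁₀ p₀₁ p₁₁ →
           (p₀₀ ≡ true → p₁₀ ≡ true → p₀₁ ≡ true → ⊥) → (p₁₀ ≡ true → p₀₀ ≡ true → p₁₁ ≡ true → ⊥) →
           (p₀₁ ≡ true → p₁₁ ≡ true → p₀₀ ≡ true → ⊥) → (p₁₁ ≡ true → p₀₁ ≡ true → p₁₀ ≡ true → ⊥) →
           boolToℕ p₀₀ + boolToℕ p₁₀ + (boolToℕ p₀₁ + boolToℕ p₁₁) ≤ 2
square≤2 true  true  true  _     c₀₀ _   _   _   = ⊥-elim (c₀₀ refl refl refl)
square≤2 true  true  false true  _   c₁₀ _   _   = ⊥-elim (c₁₀ refl refl refl)
square≤2 true  false true  true  _   _   c₀₁ _   = ⊥-elim (c₀₁ refl refl refl)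
square≤2 false true  true  true  _   _   _   c₁₁ = ⊥-elim (c₁₁ refl refl refl)
square≤2 true  true  false false _   _   _   _   = ≤-refl
square≤2 true  false true  false _   _   _   _   = ≤-refl
square≤2 true  false false true  _   _   _   _   = ≤-refl
square≤2 true  false false false _   _   _   _   = s≤s z≤n
square≤2 false true  true  false _   _   _   _   = ≤-refl
square≤2 false true  false true  _   _   _   _   = ≤-refl
square≤2 false true  false false _   _   _   _   = s≤s z≤n
square≤2 false false p₀₁   p₁₁   _   _   _   _   = +-mono-≤ (boolToℕ≤1 p₀₁) (boolToℕ≤1 p₁₁)

a+1-1≡a : ∀ a → (a ℤ.+ 1ℤ) ℤ.+ -[1+ 0 ] ≡ a
a+1-1≡a = solve-∀
  where open import Data.Integer.Tactic.RingSolver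

unitSquare≤2 : ∀ {k} {S : Subset (suc (suc k))} → MaxUnitDeg (suc (suc k)) S 1 → ∀ a b (x : Point k) →
               boolToℕ (S (a ∷ b ∷ x)) + boolToℕ (S ((a ℤ.+ 1ℤ) ∷ b ∷ x))
               + (boolToℕ (S (a ∷ (b ℤ.+ 1ℤ) ∷ x)) + boolToℕ (S ((a ℤ.+ 1ℤ) ∷ (b ℤ.+ 1ℤ) ∷ x))) ≤ 2
unitSquare≤2 deg a b x = square≤2 _ _ _ _
  (no-corner deg Sign.+ Sign.+ refl refl)
  (no-corner deg Sign.- Sign.+ (sym (a+1-1≡a a)) refl)
  (no-corner deg Sign.+ Sign.- refl (sym (a+1-1≡a b)))
  (no-corner deg Sign.- Sign.- (sym (a+1-1≡a a)) (sym (a+1-1≡a b)))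

-- Sum the square bound over a column of squares, then over the rows.
maxUnitDeg1-count : ∀ {k} {S : Subset (suc (suc k))} → MaxUnitDeg (suc (suc k)) S 1 → ∀ m →
                    2 * countB S (box (suc (suc k)) (suc m)) ≤ suc (side m) * (suc (side m) * length (box k (suc m)))
maxUnitDeg1-count {k} {S} deg m = begin
  2 * countB S (box (suc (suc k)) (suc m))  ≡⟨ cong (2 *_) count≡ ⟩
  2 * ∑< N row                             ≤⟨ ∑<-pairs-≤ N row (suc N * vol₀) row-pair ⟩
  suc N * (suc N * vol₀)                   ∎
  where
  open ≤-Reasoning
  N vol₀ : ℕ
  N = side m
  vol₀ = length (box k (suc m))
  fibre : ℕ → ℕ → ℕ
  fibre i j = countB (λ x → S (symIndex m i ∷ symIndex m j ∷ x)) (box k (suc m))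
  row : ℕ → ℕ
  row i = ∑< N (fibre i)

  count≡ : countB S (box (suc (suc k)) (suc m)) ≡ ∑< N row
  count≡ = trans (countB-box (suc k) m S) (∑<-cong N (λ i → countB-box k m _))

  square : ∀ i j → fibre i j + fibre (suc i) j + (fibre i (suc j) + fibre (suc i) (suc j)) ≤ 2 * vol₀
  square i j = countB-square≤ _ _ _ _ pointwise (box k (suc m))
    where
    at : ℕ → ℕ → Point k → ℕ
    at i′ j′ x = boolToℕ (S (symIndex m i′ ∷ symIndex m j′ ∷ x))
    pointwise : ∀ x → at i j x + at (suc i) j x + (at i (suc j) x + at (suc i) (suc j) x) ≤ 2
    pointwise x rewrite symIndex-suc m i | symIndex-suc m j = unitSquare≤2 deg (symIndex m i) (symIndex m j) x

  row-pair : ∀ i → row i + row (suc i) ≤ suc N * vol₀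
  row-pair i = *-cancelˡ-≤ 2 (begin
    2 * (row i + row (suc i))                          ≡⟨ cong (2 *_) (∑<-+ N (fibre i) (fibre (suc i))) ⟨
    2 * ∑[ j < N ] (fibre i j + fibre (suc i) j)      ≤⟨ ∑<-pairs-≤ N (λ j → fibre i j + fibre (suc i) j) (2 * vol₀) (square i) ⟩
    suc N * (2 * vol₀)                                 ≡⟨ *-assoc (suc N) 2 vol₀ ⟨
    suc N * 2 * vol₀                                   ≡⟨ cong (_* vol₀) (*-comm (suc N) 2) ⟩
    2 * suc N * vol₀                                   ≡⟨ *-assoc 2 (suc N) vol₀ ⟩
    2 * (suc N * vol₀)                                 ∎)

-- The checkerboard

oddℕ : ℕ → Bool
oddℕ zero    = false
oddℕ (suc n) = not (oddℕ n)

oddℤ : ℤ → Bool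
oddℤ (+ n)    = oddℕ n
oddℤ -[1+ n ] = not (oddℕ n)

oddSum : ∀ {k} → Point k → Bool
oddSum []      = false
oddSum (a ∷ x) = oddℤ a xor oddSum x

checkerboard : ∀ {k} → Subset k
checkerboard x = not (oddSum x)

oddℤ-+1 : ∀ a → oddℤ (a ℤ.+ 1ℤ) ≡ not (oddℤ a)
oddℤ-+1 (+ n)          = cong oddℕ (+-comm n 1)
oddℤ-+1 -[1+ zero ]    = refl
oddℤ-+1 -[1+ suc n ]   = sym (not-involutive _)

oddℤ-step : ∀ s a → oddℤ (a ℤ.+ (s ◃ 1)) ≡ not (oddℤ a)
oddℤ-step Sign.+ a = oddℤ-+1 a
oddℤ-step Sign.- a = begin
  oddℤ (a ℤ.+ -[1+ 0 ])                       ≡⟨ not-involutive _ ⟨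
  not (not (oddℤ (a ℤ.+ -[1+ 0 ])))            ≡⟨ cong not (oddℤ-+1 (a ℤ.+ -[1+ 0 ])) ⟨
  not (oddℤ (a ℤ.+ -[1+ 0 ] ℤ.+ 1ℤ))           ≡⟨ cong (not ∘ oddℤ) (back a) ⟩
  not (oddℤ a)                                 ∎
  where
  open ≡-Reasoning
  open import Data.Integer.Tactic.RingSolver
  back : ∀ a → a ℤ.+ -[1+ 0 ] ℤ.+ 1ℤ ≡ a
  back = solve-∀

oddℤ-1+ : ∀ z → oddℤ (1ℤ ℤ.+ z) ≡ not (oddℤ z)
oddℤ-1+ z = trans (cong oddℤ (ℤ.+-comm 1ℤ z)) (oddℤ-+1 z)

-- True for all x and y, but only needed, and proved, along cube1 x.
ParityOfSqDist : ∀ {k} → Point k → Point k → Set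
ParityOfSqDist x y = oddSum y ≡ oddSum x xor oddℤ (sqDist x y)

parityOfSqDist-stay : ∀ {k} a {x y : Point k} → ParityOfSqDist x y → ParityOfSqDist (a ∷ x) ((a ℤ.+ + 0) ∷ y)
parityOfSqDist-stay a {x} {y} inv rewrite ℤ.+-identityʳ a | sqDist-∷-same a x y | inv =
  sym (xor-assoc (oddℤ a) (oddSum x) _)

parityOfSqDist-step : ∀ {k} s a {x y : Point k} → ParityOfSqDist x y →
                      ParityOfSqDist (a ∷ x) ((a ℤ.+ (s ◃ 1)) ∷ y)
parityOfSqDist-step s a {x} {y} inv
  rewrite oddℤ-step s a | unitStep-square s a | oddℤ-1+ (sqDist x y) | inv = flip (oddℤ a) (oddSum x) _
  where
  flip : ∀ a b c → not a xor (b xor c) ≡ (a xor b) xor not c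
  flip false b     c = not-distribʳ-xor b c
  flip true  false c = sym (not-involutive c)
  flip true  true  c = refl

parityOfSqDist-cube1 : ∀ {k} (x : Point k) → All (ParityOfSqDist x) (cube1 x)
parityOfSqDist-cube1 []      = refl ∷ []
parityOfSqDist-cube1 (a ∷ x) =
  ++⁺ (block (parityOfSqDist-step Sign.- a {x}))
      (++⁺ (block (parityOfSqDist-stay a {x})) (++⁺ (block (parityOfSqDist-step Sign.+ a {x})) []))
  where
  block : ∀ {d} → (∀ {y} → ParityOfSqDist x y → ParityOfSqDist (a ∷ x) ((a ℤ.+ d) ∷ y)) →
          All (ParityOfSqDist (a ∷ x)) (map ((a ℤ.+ d) ∷_) (cube1 x))
  block step = map⁺ (All.map step (parityOfSqDist-cube1 x))

unitDist⇒sqDist : ∀ {k} (x y : Point k) → unitDist x y ≡ true → sqDist x y ≡ 1ℤ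
unitDist⇒sqDist x y u with sqDist x y ℤ.≟ 1ℤ
... | yes d≡1 = d≡1

checkerboard-maxUnitDeg : ∀ k n → MaxUnitDeg k checkerboard n
checkerboard-maxUnitDeg k n x even = ≤-trans (≤-reflexive (countB-none _ (All.map not-neighbour (parityOfSqDist-cube1 x)))) z≤n
  where
  odd≡false : oddSum x ≡ false
  odd≡false = trans (sym (not-involutive _)) (cong not even)
  not-neighbour : ∀ {y} → ParityOfSqDist x y → (checkerboard y ∧ unitDist x y) ≡ false
  not-neighbour {y} inv with unitDist x y in u
  ... | false = ∧-zeroʳ _
  ... | true  rewrite inv | unitDist⇒sqDist x y u | odd≡false = refl

checkerboard-count : ∀ k m → side m * length (box k (suc m))
                             ≤ 2 * countB checkerboard (box (suc k) (suc m)) + length (box k (suc m))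
checkerboard-count k m = begin
  N * vol₀                            ≤⟨ ∑<-pairs-≥ N slice vol₀ (λ i → ≤-reflexive (sym (slice-pair i))) ⟩
  2 * ∑< N slice + slice N            ≤⟨ +-monoʳ-≤ (2 * ∑< N slice) (countB≤length _ (box k (suc m))) ⟩
  2 * ∑< N slice + vol₀               ≡⟨ cong (λ c → 2 * c + vol₀) (countB-box k m checkerboard) ⟨
  2 * countB checkerboard (box (suc k) (suc m)) + vol₀ ∎
  where
  open ≤-Reasoning
  N vol₀ : ℕ
  N = side m
  vol₀ = length (box k (suc m))
  slice : ℕ → ℕ
  slice i = countB (λ x → checkerboard (symIndex m i ∷ x)) (box k (suc m))
  slice-pair : ∀ i → slice i + slice (suc i) ≡ vol₀
  slice-pair i = countB-complement _ _ flips (box k (suc m))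
    where
    flips : ∀ x → checkerboard (symIndex m (suc i) ∷ x) ≡ not (checkerboard (symIndex m i ∷ x))
    flips x rewrite symIndex-suc m i | oddℤ-+1 (symIndex m i) =
      cong not (sym (not-distribˡ-xor (oddℤ (symIndex m i)) (oddSum x)))

-- From counts to densities

ι : ℕ → ℚ
ι n = + n ℚ./ 1

toℚᵘ-ι : ∀ n → ℚ.toℚᵘ (ι n) ≡ mkℚᵘ (+ n) 0
toℚᵘ-ι n = cong ℚ.toℚᵘ (ℚ.↥p/↧p≡p (mkℚ (+ n) 0 (Coprime.sym (Coprime.1-coprimeTo n))))

toℚᵘ-[½+ε]*ι : ∀ ε V → ℚ.toℚᵘ ((½ ℚ.+ ε) ℚ.* ι V) ℚᵘ.≃ (ℚ.toℚᵘ ½ ℚᵘ.+ ℚ.toℚᵘ ε) ℚᵘ.* mkℚᵘ (+ V) 0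
toℚᵘ-[½+ε]*ι ε V = ℚᵘ.≃-trans (ℚ.toℚᵘ-homo-* (½ ℚ.+ ε) (ι V))
                               (ℚᵘ.*-cong (ℚ.toℚᵘ-homo-+ ½ ε) (ℚᵘ.≃-reflexive (toℚᵘ-ι V)))

-- Since ↥ ε ≥ 1 we have ε ≥ 1 / ↧ ε, and the hypothesis says C / V ≤ ½ + 1 / ↧ ε.
ι≤[½+ε]*ι : ∀ {ε} → 0ℚ ℚ.< ε → ∀ C V → 2 * ℚ.↧ₙ ε * C ≤ (ℚ.↧ₙ ε + 2) * V → ι C ℚ.≤ (½ ℚ.+ ε) ℚ.* ι V
ι≤[½+ε]*ι {ε@(mkℚ +[1+ p ] d _)} _ C V hyp = ℚ.toℚᵘ-cancel-≤
  (ℚᵘ.≤-respʳ-≃ (ℚᵘ.≃-sym (toℚᵘ-[½+ε]*ι ε V)) (subst (ℚᵘ._≤ ((ℚ.toℚᵘ ½ ℚᵘ.+ ℚ.toℚᵘ ε) ℚᵘ.* mkℚᵘ (+ V) 0)) (sym (toℚᵘ-ι C)) (ℚᵘ.*≤* cross)))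
  where
  a b : ℕ
  a = suc d
  b = suc p
  nat : C * (2 * a * 1) ≤ (1 * a + b * 2) * V * 1
  nat = begin
    C * (2 * a * 1)         ≡⟨ trans (cong (C *_) (*-identityʳ (2 * a))) (*-comm C (2 * a)) ⟩
    2 * a * C               ≤⟨ hyp ⟩
    (a + 2) * V             ≤⟨ *-monoˡ-≤ V (+-mono-≤ (≤-reflexive (sym (*-identityˡ a))) (*-monoˡ-≤ 2 {1} {b} (s≤s z≤n))) ⟩
    (1 * a + b * 2) * V     ≡⟨ *-identityʳ ((1 * a + b * 2) * V) ⟨
    (1 * a + b * 2) * V * 1 ∎
    where open ≤-Reasoning
  cross : + C ℤ.* + (2 * a * 1) ℤ.≤ (+ 1 ℤ.* + a ℤ.+ + b ℤ.* + 2) ℤ.* + V ℤ.* + 1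
  cross = begin
    + C ℤ.* + (2 * a * 1)                          ≡⟨ ℤ.pos-* C (2 * a * 1) ⟨
    + (C * (2 * a * 1))                             ≤⟨ ℤ.+≤+ nat ⟩
    + ((1 * a + b * 2) * V * 1)                     ≡⟨ trans (ℤ.pos-* ((1 * a + b * 2) * V) 1) (cong (ℤ._* + 1) (trans (ℤ.pos-* (1 * a + b * 2) V)
                                                         (cong (ℤ._* + V) (cong₂ ℤ._+_ (ℤ.pos-* 1 a) (ℤ.pos-* b 2))))) ⟩
    (+ 1 ℤ.* + a ℤ.+ + b ℤ.* + 2) ℤ.* + V ℤ.* + 1  ∎
    where open ℤ.≤-Reasoning
ι≤[½+ε]*ι {mkℚ +0       _ _} (ℚ.*<* (ℤ.+<+ ()))
ι≤[½+ε]*ι {mkℚ -[1+ _ ] _ _} (ℚ.*<* ())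

-- As above, C / V ≥ ½ - 1 / ↧ ε ≥ ½ - ε.
[½-ε]*ι≤ι : ∀ {ε} → 0ℚ ℚ.< ε → ∀ C V → ℚ.↧ₙ ε * V ≤ 2 * ℚ.↧ₙ ε * C + 2 * V → (½ ℚ.- ε) ℚ.* ι V ℚ.≤ ι C
[½-ε]*ι≤ι {ε@(mkℚ +[1+ p ] d _)} _ C V hyp = ℚ.toℚᵘ-cancel-≤
  (ℚᵘ.≤-respˡ-≃ (ℚᵘ.≃-sym (toℚᵘ-[½+ε]*ι (ℚ.- ε) V))
    (subst (((ℚ.toℚᵘ ½ ℚᵘ.+ ℚ.toℚᵘ (ℚ.- ε)) ℚᵘ.* mkℚᵘ (+ V) 0) ℚᵘ.≤_) (sym (toℚᵘ-ι C)) (ℚᵘ.*≤* cross)))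
  where
  a b : ℕ
  a = suc d
  b = suc p
  nat : a * V ≤ 2 * a * C + 2 * b * V
  nat = ≤-trans hyp (+-monoʳ-≤ (2 * a * C) (*-monoˡ-≤ V (*-monoʳ-≤ 2 {1} {b} (s≤s z≤n))))
  int : + a ℤ.* + V ℤ.≤ + 2 ℤ.* + a ℤ.* + C ℤ.+ + 2 ℤ.* + b ℤ.* + V
  int = subst₂ ℤ._≤_ (ℤ.pos-* a V)
          (cong₂ ℤ._+_ (trans (ℤ.pos-* (2 * a) C) (cong (ℤ._* + C) (ℤ.pos-* 2 a)))
                       (trans (ℤ.pos-* (2 * b) V) (cong (ℤ._* + V) (ℤ.pos-* 2 b))))
          (ℤ.+≤+ nat)
  cross : (+ 1 ℤ.* + a ℤ.+ -[1+ p ] ℤ.* + 2) ℤ.* + V ℤ.* + 1 ℤ.≤ + C ℤ.* + (2 * a * 1)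
  cross = subst₂ ℤ._≤_ (expand (+ a) (+ b) (+ V)) (trans (cancel (+ a) (+ b) (+ C) (+ V))
                                         (cong (+ C ℤ.*_) (sym (trans (ℤ.pos-* (2 * a) 1) (cong (ℤ._* + 1) (ℤ.pos-* 2 a))))))
            (ℤ.+-monoˡ-≤ (ℤ.- (+ 2 ℤ.* + b ℤ.* + V)) int)
    where
    open import Data.Integer.Tactic.RingSolver
    expand : ∀ A B V′ → A ℤ.* V′ ℤ.- + 2 ℤ.* B ℤ.* V′ ≡ (+ 1 ℤ.* A ℤ.+ (ℤ.- B) ℤ.* + 2) ℤ.* V′ ℤ.* + 1
    expand = solve-∀
    cancel : ∀ A B C′ V′ → + 2 ℤ.* A ℤ.* C′ ℤ.+ + 2 ℤ.* B ℤ.* V′ ℤ.- + 2 ℤ.* B ℤ.* V′ ≡ C′ ℤ.* (+ 2 ℤ.* A ℤ.* + 1)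
    cancel = solve-∀
[½-ε]*ι≤ι {mkℚ +0       _ _} (ℚ.*<* (ℤ.+<+ ()))
[½-ε]*ι≤ι {mkℚ -[1+ _ ] _ _} (ℚ.*<* ())

module _ where
  open import Data.Rational.Solver using (module +-*-Solver)
  open +-*-Solver

  p-[p-q]≡q : ∀ a y → a ℚ.- (a ℚ.- y) ≡ y
  p-[p-q]≡q = solve 2 (λ a y → a :- (a :- y) := y) refl

  p+[q-p]≡q : ∀ b x → b ℚ.+ (x ℚ.- b) ≡ x
  p+[q-p]≡q = solve 2 (λ b x → b :+ (x :- b) := x) refl

p<q⇒0<q-p : ∀ {a b} → b ℚ.< a → 0ℚ ℚ.< a ℚ.- b
p<q⇒0<q-p {a} {b} b<a = subst (ℚ._< a ℚ.- b) (ℚ.+-inverseʳ b) (ℚ.+-monoˡ-< (ℚ.- b) b<a)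

p-q≤p : ∀ p {q} → 0ℚ ℚ.< q → p ℚ.- q ℚ.≤ p
p-q≤p p q>0 = subst (p ℚ.- _ ℚ.≤_) (ℚ.+-identityʳ p) (ℚ.+-monoʳ-≤ p (ℚ.neg-antimono-≤ (ℚ.<⇒≤ q>0)))

p≤p+q : ∀ p {q} → 0ℚ ℚ.< q → p ℚ.≤ p ℚ.+ q
p≤p+q p q>0 = subst (ℚ._≤ p ℚ.+ _) (ℚ.+-identityʳ p) (ℚ.+-monoʳ-≤ p (ℚ.<⇒≤ q>0))

approx⇒≤ : ∀ {a b} → (∀ ε δ → 0ℚ ℚ.< ε → 0ℚ ℚ.< δ → a ℚ.- ε ℚ.≤ b ℚ.+ δ) → a ℚ.≤ b
approx⇒≤ {a} {b} approx with a ℚ.≤? b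
... | yes a≤b = a≤b
... | no  a≰b with ℚ.<-dense (ℚ.≰⇒> a≰b)
...   | x , b<x , x<a with ℚ.<-dense x<a
...     | y , x<y , y<a = ⊥-elim (ℚ.<-irrefl refl (ℚ.<-≤-trans x<y y≤x))
  where
  y≤x : y ℚ.≤ x
  y≤x = subst₂ ℚ._≤_ (p-[p-q]≡q a y) (p+[q-p]≡q b x)
          (approx (a ℚ.- y) (x ℚ.- b) (p<q⇒0<q-p y<a) (p<q⇒0<q-p b<x))

*ι-mono : ∀ V {a b} → a ℚ.≤ b → a ℚ.* ι V ℚ.≤ b ℚ.* ι V
*ι-mono V = ℚ.*-monoʳ-≤-nonNeg (ι V) {{ℚ.normalize-nonNeg V 1}}

*ι-cancel : ∀ {V a b} → 1 ≤ V → a ℚ.* ι V ℚ.≤ b ℚ.* ι V → a ℚ.≤ b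
*ι-cancel {suc V} _ = ℚ.*-cancelʳ-≤-pos (ι (suc V)) {{ℚ.normalize-pos (suc V) 1}}

LowerDensity≥ : (k : ℕ) → Subset k → ℚ → Set
LowerDensity≥ k S q = ∀ ε → 0ℚ ℚ.< ε → ∃[ R ] ∀ r → R ≤ r → (q ℚ.- ε) ℚ.* vol k r ℚ.≤ cnt k S r

lowerDensity⇒upperDensity≥ : ∀ {k S q ε} → 0ℚ ℚ.< ε → LowerDensity≥ k S q → UpperDensity≥ k S (q ℚ.- ε)
lowerDensity⇒upperDensity≥ {k} {S} {q} {ε} ε>0 lower ε′ ε′>0 R with lower ε′ ε′>0
... | R′ , above = R + R′ , m≤m+n R R′ ,
  ℚ.≤-trans (*ι-mono (length (box k (R + R′))) (ℚ.+-monoˡ-≤ (ℚ.- ε′) (p-q≤p q ε>0))) (above (R + R′) (m≤n+m R′ R))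

Δ≥-from-lowerDensity : ∀ {k n S q} → MaxUnitDeg k S n → LowerDensity≥ k S q → Δ≥ k n q
Δ≥-from-lowerDensity {k} {S = S} {q} deg lower ε ε>0 = S , deg , lowerDensity⇒upperDensity≥ {k} {S} {q} ε>0 lower

upperDensity-sandwich : ∀ {k S a b} → UpperDensity≥ k S a → UpperDensity≤ k S b → a ℚ.≤ b
upperDensity-sandwich {k} {S} {a} {b} ≥a ≤b = approx⇒≤ squeeze
  where
  squeeze : ∀ ε δ → 0ℚ ℚ.< ε → 0ℚ ℚ.< δ → a ℚ.- ε ℚ.≤ b ℚ.+ δ
  squeeze ε δ ε>0 δ>0 with ≤b δ δ>0
  ... | R , below with ≥a ε ε>0 (suc R)
  ...   | suc m , s≤s R≤m , above =
    *ι-cancel (length-box-pos k m) (ℚ.≤-trans above (below (suc m) (≤-trans R≤m (n≤1+n m))))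

Δ≥⇒Δ≤⇒≤ : ∀ {k n a b} → Δ≥ k n a → Δ≤ k n b → a ℚ.≤ b
Δ≥⇒Δ≤⇒≤ {k} {a = a} {b} Δ≥a Δ≤b = approx⇒≤ λ ε δ ε>0 δ>0 → case Δ≥a ε ε>0 of λ where
  (S , deg , ≥a-ε) → ℚ.≤-trans (upperDensity-sandwich {k} {S} ≥a-ε (Δ≤b S deg)) (p≤p+q b δ>0)

-- (N + 1)² / (2 N²) ≤ ½ + 1 / q as soon as 2 q ≤ N.
upper-arith : ∀ q N C L .{{_ : NonZero N}} → 2 * q ≤ N → 2 * C ≤ suc N * (suc N * L) →
              2 * q * C ≤ (q + 2) * (N * (N * L))
upper-arith q N C L 2q≤N 2C≤ = begin
  2 * q * C                            ≡⟨ e₁ q C ⟩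
  q * (2 * C)                          ≤⟨ *-monoʳ-≤ q 2C≤ ⟩
  q * (suc N * (suc N * L))            ≡⟨ e₂ q N L ⟩
  (q * (N * N) + (2 * q * N + q)) * L  ≤⟨ *-monoˡ-≤ L (+-monoʳ-≤ (q * (N * N)) cross-terms) ⟩
  (q * (N * N) + (N * N + N * N)) * L  ≡⟨ e₃ q N L ⟩
  (q + 2) * (N * (N * L))              ∎
  where
  open ≤-Reasoning
  open import Data.Nat.Tactic.RingSolver
  cross-terms : 2 * q * N + q ≤ N * N + N * N
  cross-terms = +-mono-≤ (*-monoˡ-≤ N 2q≤N) (≤-trans (m≤n*m q 2) (≤-trans 2q≤N (m≤m*n N N)))
  e₁ : ∀ q C → 2 * q * C ≡ q * (2 * C)
  e₁ = solve-∀
  e₂ : ∀ q N L → q * (suc N * (suc N * L)) ≡ (q * (N * N) + (2 * q * N + q)) * L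
  e₂ = solve-∀
  e₃ : ∀ q N L → (q * (N * N) + (N * N + N * N)) * L ≡ (q + 2) * (N * (N * L))
  e₃ = solve-∀

lower-arith : ∀ q N C L → q ≤ N → N * L ≤ 2 * C + L → q * (N * L) ≤ 2 * q * C + 2 * (N * L)
lower-arith q N C L q≤N NL≤ = begin
  q * (N * L)              ≤⟨ *-monoʳ-≤ q NL≤ ⟩
  q * (2 * C + L)          ≡⟨ e q C L ⟩
  2 * q * C + q * L        ≤⟨ +-monoʳ-≤ (2 * q * C) (≤-trans (*-monoˡ-≤ L q≤N) (m≤n*m (N * L) 2)) ⟩
  2 * q * C + 2 * (N * L)  ∎
  where
  open ≤-Reasoning
  open import Data.Nat.Tactic.RingSolver
  e : ∀ q C L → q * (2 * C + L) ≡ 2 * q * C + q * L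
  e = solve-∀

checkerboard-lowerDensity : ∀ k → LowerDensity≥ (suc k) checkerboard ½
checkerboard-lowerDensity k ε ε>0 = suc (ℚ.↧ₙ ε) , above
  where
  above : ∀ r → suc (ℚ.↧ₙ ε) ≤ r → (½ ℚ.- ε) ℚ.* vol (suc k) r ℚ.≤ cnt (suc k) checkerboard r
  above (suc m) (s≤s q≤m) = subst (λ V → (½ ℚ.- ε) ℚ.* ι V ℚ.≤ ι C) (sym (length-box k m))
    ([½-ε]*ι≤ι ε>0 C (side m * L)
      (lower-arith (ℚ.↧ₙ ε) (side m) C L (≤-trans q≤m (≤-trans (m≤n*m m 2) (n≤1+n _))) (checkerboard-count k m)))
    where
    C L : ℕ
    C = countB checkerboard (box (suc k) (suc m))
    L = length (box k (suc m))

maxUnitDeg1-Δ≤½ : ∀ k → Δ≤ (suc (suc k)) 1 ½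
maxUnitDeg1-Δ≤½ k S deg ε ε>0 = suc (ℚ.↧ₙ ε) , below
  where
  below : ∀ r → suc (ℚ.↧ₙ ε) ≤ r → cnt (suc (suc k)) S r ℚ.≤ (½ ℚ.+ ε) ℚ.* vol (suc (suc k)) r
  below (suc m) (s≤s q≤m) = subst (λ V → ι C ℚ.≤ (½ ℚ.+ ε) ℚ.* ι V) (sym vol≡)
    (ι≤[½+ε]*ι ε>0 C (side m * (side m * L))
      (upper-arith (ℚ.↧ₙ ε) (side m) C L (≤-trans (*-monoʳ-≤ 2 q≤m) (n≤1+n _)) (maxUnitDeg1-count deg m)))
    where
    C L : ℕ
    C = countB S (box (suc (suc k)) (suc m))
    L = length (box k (suc m))
    vol≡ : length (box (suc (suc k)) (suc m)) ≡ side m * (side m * L)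
    vol≡ = trans (length-box (suc k) m) (cong (side m *_) (length-box k m))

¬Δ<-of-bounds : ∀ {k m n q} → Δ≥ k m q → Δ≤ k n q → ¬ Δ< k m n
¬Δ<-of-bounds {k} {m} {n} {q} Δₘ≥q Δₙ≤q (qₘ , qₙ , qₘ<qₙ , Δₘ≤qₘ , Δₙ≥qₙ) =
  ℚ.<-irrefl refl (ℚ.<-≤-trans qₘ<qₙ (ℚ.≤-trans qₙ≤q q≤qₘ))
  where
  qₙ≤q : qₙ ℚ.≤ q
  qₙ≤q = Δ≥⇒Δ≤⇒≤ {k} {n} {qₙ} {q} Δₙ≥qₙ Δₙ≤q
  q≤qₘ : q ℚ.≤ qₘ
  q≤qₘ = Δ≥⇒Δ≤⇒≤ {k} {m} {q} {qₘ} Δₘ≥q Δₘ≤qₘ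

mainTheorem9 : ∀ (k : ℕ) → 2 ≤ k → Δ≡ k 1 ½ × ¬ ΔStrictlyIncreasing k
mainTheorem9 (suc (suc k)) (s≤s (s≤s z≤n)) = (Δ≤½ , Δ≥½ 1) , λ increasing →
  ¬Δ<-of-bounds {K} {0} {1} {½} (Δ≥½ 0) Δ≤½ (increasing 0 1 (s≤s z≤n))
  where
  K : ℕ
  K = suc (suc k)
  Δ≤½ : Δ≤ K 1 ½
  Δ≤½ = maxUnitDeg1-Δ≤½ k
  Δ≥½ : ∀ n → Δ≥ K n ½
  Δ≥½ n = Δ≥-from-lowerDensity {K} {n} {checkerboard} {½}
            (checkerboard-maxUnitDeg K n) (checkerboard-lowerDensity (suc k))
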